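{- Let $n \geq 2$ and let $n^2 \cdot S^1_4$ denote the disjoint union of $n^2$ copies of the sunlet $S^1_4$. Then there is a homomorphism $\varphi: n^2 \cdot S^1_4 \to C_{2n} \,\Box\, C_{2n}$ which is a covering and is 2-to-1 on vertices, such that the restriction of $\varphi$ to the disjoint union of the $n^2$ cycles $Z(S^1_4)$ is an isomorphism onto the union of the odd squares, and $\varphi$ is compatible with the FSM orientation of $n^2 \cdot S^1_4$ and the raster orientation of $C_{2n} \,\Box\, C_{2n}$.
   Context: For $p \geq 3$, the sunlet $S^1_p$ is the graph obtained from a cycle $C_p$ by attaching one pendant edge at each vertex of the cycle ($2p$ vertices, $2p$ edges); $Z(S)$ denotes the unique cycle of a sunlet $S$. View $C_{2n} \,\Box\, C_{2n}$ as a $2n \times 2n$ square grid with opposite sides identified: vertices $(r,c)$ with row index $r$ and column index $c$ in $\{1,\dots,2n\}$ taken mod $2n$ (rows numbered from top to bottom, columns from left to right), row edges $\{(r,c),(r,c+1)\}$ and column edges $\{(r,c),(r+1,c)\}$. The raster orientation directs all odd-indexed rows left-to-right ($(r,c)\to(r,c+1)$ for $r$ odd), all even-indexed rows right-to-left ($(r,c+1)\to(r,c)$ for $r$ even), all odd-indexed columns bottom-to-top ($(r+1,c)\to(r,c)$ for $c$ odd), and all even-indexed columns top-to-bottom ($(r,c)\to(r+1,c)$ for $c$ even). Call the edges $\{1,2\},\{3,4\},\dots,\{2n-1,2n\}$ of $C_{2n}$ (on vertices $1,\dots,2n$) its odd-indexed edges; the odd squares are the $n^2$ vertex-disjoint 4-cycles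 obtained as products of two odd-indexed edges, i.e. for $k,l \in \{0,\dots,n-1\}$ the 4-cycle $(2k+1,2l+1),(2k+1,2l+2),(2k+2,2l+2),(2k+2,2l+1)$; each is a directed cycle in the raster orientation. A homomorphism $\varphi: G \to H$ is a map $V(G)\to V(H)$ sending edges to edges; it is a covering if the induced map on edge sets is a bijection; it is 2-to-1 on vertices if every vertex of $H$ has exactly two preimages. The FSM orientation of a sunlet orients its cycle as a directed cycle and each pendant edge from its degree-1 vertex toward the cycle vertex; on a disjoint union of sunlets each component is so oriented. $\varphi$ is compatible with orientations if $(\varphi(u),\varphi(w))$ is an arc whenever $(u,w)$ is an arc. -}

module Defs where

open import Data.Nat using (ℕ; zero; suc; _*_)
open import Data.Nat.DivMod using (_%_; m%n<n)
open import Data.Fin using (Fin; toℕ; fromℕ<)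
open import Data.Bool using (Bool; true; false; if_then_else_)
open import Data.Product using (Σ; ∃; _×_; _,_)
open import Data.Sum using (_⊎_)
open import Relation.Binary.PropositionalEquality using (_≡_)

next : ∀ {m} → Fin m → Fin m
next {suc m} i = fromℕ< (m%n<n (suc (toℕ i)) (suc m))

even : ℕ → Bool
even zero = true
even (suc zero) = false
even (suc (suc k)) = even k

SamePair : ∀ {A : Set} → A → A → A → A → Set
SamePair a b x y = (a ≡ x × b ≡ y) ⊎ (a ≡ y × b ≡ x)

-- In each component: cycle vertices (cyc , i) and pendant vertices
-- (pend , i), i : Fin 4, with cycle edges (cyc,i)-(cyc,i+1 mod 4) and
-- pendant edges (pend,i)-(cyc,i).

data Part : Set where
  cyc pend : Part

Comp : ℕ → Set
Comp n = Fin n × Fin n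

SV : ℕ → Set
SV n = Comp n × Part × Fin 4

-- edges: (k , cyc , i) is the cycle edge from cycle vertex i to i+1;
--        (k , pend , i) is the pendant edge at cycle vertex i.
SE : ℕ → Set
SE n = Comp n × Part × Fin 4

stail : ∀ {n} → SE n → SV n
stail (k , cyc , i) = (k , cyc , i)
stail (k , pend , i) = (k , pend , i)

shead : ∀ {n} → SE n → SV n
shead (k , cyc , i) = (k , cyc , next i)
shead (k , pend , i) = (k , cyc , i)

FSMArc : ∀ {n} → SV n → SV n → Set
FSMArc {n} u w = Σ (SE n) λ e → stail e ≡ u × shead e ≡ w

CV : ℕ → Set
CV n = Comp n × Fin 4

cv : ∀ {n} → CV n → SV n
cv (k , i) = (k , cyc , i)

CycAdj : ∀ {n} → CV n → CV n → Set
CycAdj {n} u w = Σ (Comp n × Fin 4) λ { (k , i) →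
  SamePair (stail (k , cyc , i)) (shead (k , cyc , i)) (cv u) (cv w) }

-- The torus grid C_m □ C_m (m = 2n), 0-indexed: paper's row/column j
-- is index j-1 here, so paper-odd indices are even here.

GV : ℕ → Set
GV m = Fin m × Fin m

data Dir : Set where
  horiz vert : Dir

GE : ℕ → Set
GE m = Fin m × Fin m × Dir

gend₁ : ∀ {m} → GE m → GV m
gend₁ (r , c , _) = (r , c)

gend₂ : ∀ {m} → GE m → GV m
gend₂ (r , c , horiz) = (r , next c)
gend₂ (r , c , vert) = (next r , c)

GAdj : ∀ {m} → GV m → GV m → Set
GAdj {m} x y = Σ (GE m) λ g → SamePair (gend₁ g) (gend₂ g) x y

gtail : ∀ {m} → GE m → GV m
gtail (r , c , horiz) = if even (toℕ r) then (r , c) else (r , next c)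
gtail (r , c , vert) = if even (toℕ c) then (next r , c) else (r , c)

ghead : ∀ {m} → GE m → GV m
ghead (r , c , horiz) = if even (toℕ r) then (r , next c) else (r , c)
ghead (r , c , vert) = if even (toℕ c) then (r , c) else (next r , c)

RasterArc : ∀ {m} → GV m → GV m → Set
RasterArc {m} x y = Σ (GE m) λ g → gtail g ≡ x × ghead g ≡ y

-- odd squares (paper's indexing): products of odd-indexed edges
-- {2k+1,2k+2}; 0-indexed their edges are the row edges starting at an
-- even column and the column edges starting at an even row.
OddSqEdge : ∀ {m} → GE m → Set
OddSqEdge (r , c , horiz) = even (toℕ c) ≡ true
OddSqEdge (r , c , vert) = even (toℕ r) ≡ true

OddAdj : ∀ {m} → GV m → GV m → Set
OddAdj {m} x y = Σ (GE m) λ g → OddSqEdge g × SamePair (gend₁ g) (gend₂ g) x y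

OddVertex : ∀ {m} → GV m → Set
OddVertex {m} x = Σ (GE m) λ g → OddSqEdge g × (gend₁ g ≡ x ⊎ gend₂ g ≡ x)

{-# OPTIONS --safe #-}
module Submission where

open import Defs
open import Data.Nat using (ℕ; zero; suc; _+_; _*_; _≤_; s≤s; z≤n)
open import Data.Nat.Properties using (1+n≢n; ≤-trans; m≤n+m; +-suc; *-suc; *-comm)
open import Data.Nat.DivMod using (_%_; n%n≡0; %-congʳ; m<n⇒m%n≡m; m%n*o≡m*o%[n*o])
open import Data.Nat.Tactic.RingSolver using (solve-∀)
open import Data.Fin.Base using (Fin; toℕ; fromℕ; inject₁; cast; combine; remQuot)
open import Data.Fin.Patterns using (0F; 1F; 2F; 3F)
open import Data.Fin.Properties
  using (0≢1+n; toℕ-injective; toℕ-fromℕ<; toℕ-fromℕ; toℕ-inject₁; toℕ<n; toℕ-cast; toℕ-combine;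
         cast-involutive; remQuot-combine; combine-remQuot)
open import Data.Fin.Relation.Unary.Top using (view; ‵fromℕ; ‵inject₁)
open import Data.Bool using (true; false)
open import Data.Product using (Σ; _×_; _,_; proj₁; proj₂; uncurry)
open import Data.Sum using (_⊎_; inj₁; inj₂)
open import Data.Empty using (⊥-elim)
open import Function using (_∘_)
open import Relation.Binary.PropositionalEquality
  using (_≡_; _≢_; refl; sym; trans; cong; cong₂; subst; subst₂; module ≡-Reasoning)
open import Relation.Nullary using (¬_)

-- Writing an index of C_2n as 2q + b, the odd squares are the blocks {2k, 2k+1} × {2l, 2l+1}; they
-- partition the torus and each is a directed 4-cycle of the raster orientation. Every vertex v has
-- in- and out-degree 2, one arc of each kind lying on its odd square, so exactly one arc enters v
-- from outside its square and exactly one leaves v. Sending the cycle of the (k, l)-th sunlet onto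
-- the (k, l)-th odd square and the pendant at a cycle vertex v to the tail of the arc entering v from
-- outside therefore hits every vertex once as a cycle vertex and once as a pendant vertex, and the
-- pendant edges go bijectively onto the non-square edges.

module _ {A : Set} where

  SamePair-sym : {a b x y : A} → SamePair a b x y → SamePair x y a b
  SamePair-sym (inj₁ (refl , refl)) = inj₁ (refl , refl)
  SamePair-sym (inj₂ (refl , refl)) = inj₂ (refl , refl)

  SamePair-trans : {a b x y p q : A} → SamePair a b x y → SamePair x y p q → SamePair a b p q
  SamePair-trans (inj₁ (refl , refl)) s = s
  SamePair-trans (inj₂ (refl , refl)) (inj₁ (refl , refl)) = inj₂ (refl , refl)
  SamePair-trans (inj₂ (refl , refl)) (inj₂ (refl , refl)) = inj₁ (refl , refl)

  SamePair-∋ˡ : {a b x y : A} → SamePair a b x y → a ≡ x ⊎ b ≡ x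
  SamePair-∋ˡ (inj₁ (a≡x , _)) = inj₁ a≡x
  SamePair-∋ˡ (inj₂ (_ , b≡x)) = inj₂ b≡x

  module _ {B : Set} (f : A → B) where

    SamePair-map : {a b x y : A} → SamePair a b x y → SamePair (f a) (f b) (f x) (f y)
    SamePair-map (inj₁ (refl , refl)) = inj₁ (refl , refl)
    SamePair-map (inj₂ (refl , refl)) = inj₂ (refl , refl)

    SamePair-reflect : (∀ {u w} → f u ≡ f w → u ≡ w) →
                       {a b x y : A} → SamePair (f a) (f b) (f x) (f y) → SamePair a b x y
    SamePair-reflect f-inj (inj₁ (p , q)) = inj₁ (f-inj p , f-inj q)
    SamePair-reflect f-inj (inj₂ (p , q)) = inj₂ (f-inj p , f-inj q)

module _ {m : ℕ} where

  toℕ-next : (i : Fin (suc m)) → toℕ (next i) ≡ suc (toℕ i) % suc m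
  toℕ-next i = toℕ-fromℕ< _

  toℕ≡suc⇒next≡ : {i j : Fin (suc m)} → toℕ j ≡ suc (toℕ i) → next i ≡ j
  toℕ≡suc⇒next≡ {i} {j} eq = toℕ-injective (begin
    toℕ (next i)          ≡⟨ toℕ-next i ⟩
    suc (toℕ i) % suc m   ≡⟨ cong (_% suc m) (sym eq) ⟩
    toℕ j % suc m         ≡⟨ m<n⇒m%n≡m (toℕ<n j) ⟩
    toℕ j                 ∎)
    where open ≡-Reasoning

  next-fromℕ : next (fromℕ m) ≡ 0F
  next-fromℕ = toℕ-injective (begin
    toℕ (next (fromℕ m))          ≡⟨ toℕ-next (fromℕ m) ⟩
    suc (toℕ (fromℕ m)) % suc m   ≡⟨ cong (λ k → suc k % suc m) (toℕ-fromℕ m) ⟩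
    suc m % suc m                 ≡⟨ n%n≡0 (suc m) ⟩
    0                             ∎)
    where open ≡-Reasoning

  next-inject₁ : (i : Fin m) → next (inject₁ i) ≡ Fin.suc i
  next-inject₁ i = toℕ≡suc⇒next≡ (cong suc (sym (toℕ-inject₁ i)))

  prev : Fin (suc m) → Fin (suc m)
  prev 0F = fromℕ m
  prev (Fin.suc i) = inject₁ i

  next-prev : (i : Fin (suc m)) → next (prev i) ≡ i
  next-prev 0F = next-fromℕ
  next-prev (Fin.suc i) = next-inject₁ i

  prev-next : (i : Fin (suc m)) → prev (next i) ≡ i
  prev-next i with view i
  ... | ‵fromℕ = cong prev next-fromℕ
  ... | ‵inject₁ j = cong prev (next-inject₁ j)

next-≢ : ∀ {m} → 1 ≤ m → (i : Fin (suc m)) → next i ≢ i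
next-≢ {suc m} _ i with view i
... | ‵fromℕ = λ eq → 0≢1+n (trans (sym next-fromℕ) eq)
... | ‵inject₁ j = λ eq → 1+n≢n (begin
  suc (toℕ j)              ≡⟨ cong toℕ (next-inject₁ j) ⟨
  toℕ (next (inject₁ j))   ≡⟨ cong toℕ eq ⟩
  toℕ (inject₁ j)          ≡⟨ toℕ-inject₁ j ⟩
  toℕ j                    ∎)
  where open ≡-Reasoning

module _ {N : ℕ} where

  join : Fin N → Fin 2 → Fin (2 * N)
  join q b = cast (*-comm N 2) (combine q b)

  split : Fin (2 * N) → Fin N × Fin 2
  split i = remQuot 2 (cast (*-comm 2 N) i)

  split-join : (q : Fin N) (b : Fin 2) → split (join q b) ≡ (q , b)
  split-join q b = trans (cong (remQuot 2) (cast-involutive (*-comm 2 N) (*-comm N 2) (combine q b)))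
                         (remQuot-combine q b)

  join-split : (i : Fin (2 * N)) → uncurry join (split i) ≡ i
  join-split i = trans (cong (cast (*-comm N 2)) (combine-remQuot {N} 2 (cast (*-comm 2 N) i)))
                       (cast-involutive (*-comm N 2) (*-comm 2 N) i)

  join-injective : {q q′ : Fin N} {b b′ : Fin 2} → join q b ≡ join q′ b′ → (q , b) ≡ (q′ , b′)
  join-injective {q} {q′} {b} {b′} eq =
    trans (sym (split-join q b)) (trans (cong split eq) (split-join q′ b′))

  join-elim : (P : Fin (2 * N) → Set) → (∀ q b → P (join q b)) → ∀ i → P i
  join-elim P P-join i = subst P (join-split i) (P-join _ _)

  2·_ : Fin N → Fin (2 * N)
  2· q = join q 0F

  1+2·_ : Fin N → Fin (2 * N)
  1+2· q = join q 1F

  toℕ-join : (q : Fin N) (b : Fin 2) → toℕ (join q b) ≡ 2 * toℕ q + toℕ b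
  toℕ-join q b = trans (toℕ-cast _ (combine q b)) (toℕ-combine q b)

even-2*+ : ∀ k r → even (2 * k + r) ≡ even r
even-2*+ zero r = refl
even-2*+ (suc k) r = trans (cong (λ x → even (x + r)) (*-suc 2 k)) (even-2*+ k r)

even-join : ∀ {N} (q : Fin N) (b : Fin 2) → even (toℕ (join q b)) ≡ even (toℕ b)
even-join q b = trans (cong even (toℕ-join q b)) (even-2*+ (toℕ q) (toℕ b))

even-2· : ∀ {N} (q : Fin N) → even (toℕ (2· q)) ≡ true
even-2· q = even-join q 0F

even-1+2· : ∀ {N} (q : Fin N) → even (toℕ (1+2· q)) ≡ false
even-1+2· q = even-join q 1F

module _ {m : ℕ} where

  next-2· : (q : Fin (suc m)) → next (2· q) ≡ 1+2· q
  next-2· q = toℕ≡suc⇒next≡ (begin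
    toℕ (1+2· q)          ≡⟨ toℕ-join q 1F ⟩
    2 * toℕ q + 1         ≡⟨ +-suc (2 * toℕ q) 0 ⟩
    suc (2 * toℕ q + 0)   ≡⟨ cong suc (toℕ-join q 0F) ⟨
    suc (toℕ (2· q))      ∎)
    where open ≡-Reasoning

  next-1+2· : (q : Fin (suc m)) → next (1+2· q) ≡ 2· next q
  next-1+2· q = toℕ-injective (begin
    toℕ (next (1+2· q))                   ≡⟨ toℕ-next (1+2· q) ⟩
    suc (toℕ (1+2· q)) % (2 * suc m)      ≡⟨ cong (λ k → suc k % (2 * suc m)) (toℕ-join q 1F) ⟩
    suc (2 * toℕ q + 1) % (2 * suc m)     ≡⟨ %-congʳ {o = suc (2 * toℕ q + 1)} (*-comm 2 (suc m)) ⟩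
    suc (2 * toℕ q + 1) % (suc m * 2)     ≡⟨ cong (_% (suc m * 2)) (2k+2≡[k+1]*2 (toℕ q)) ⟩
    suc (toℕ q) * 2 % (suc m * 2)         ≡⟨ m%n*o≡m*o%[n*o] (suc (toℕ q)) (suc m) 2 ⟨
    suc (toℕ q) % suc m * 2               ≡⟨ cong (_* 2) (toℕ-next q) ⟨
    toℕ (next q) * 2                      ≡⟨ k*2≡2k+0 (toℕ (next q)) ⟩
    2 * toℕ (next q) + 0                  ≡⟨ toℕ-join (next q) 0F ⟨
    toℕ (2· next q)                       ∎)
    where
    open ≡-Reasoning
    2k+2≡[k+1]*2 : ∀ k → suc (2 * k + 1) ≡ suc k * 2
    2k+2≡[k+1]*2 = solve-∀
    k*2≡2k+0 : ∀ k → k * 2 ≡ 2 * k + 0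
    k*2≡2k+0 = solve-∀

  next²-join : (q : Fin (suc m)) (b : Fin 2) → next (next (join q b)) ≡ join (next q) b
  next²-join q 0F = trans (cong next (next-2· q)) (next-1+2· q)
  next²-join q 1F = trans (cong next (next-1+2· q)) (next-2· (next q))

  next²-≢ : 1 ≤ m → (i : Fin (2 * suc m)) → next (next i) ≢ i
  next²-≢ 1≤m = join-elim (λ i → next (next i) ≢ i) λ q b eq →
    next-≢ 1≤m q (cong proj₁ (join-injective (trans (sym (next²-join q b)) eq)))

  next-≢-2* : (i : Fin (2 * suc m)) → next i ≢ i
  next-≢-2* = next-≢ (≤-trans (s≤s z≤n) (m≤n+m (suc (m + 0)) m))

raster-ends : ∀ {M} (g : GE M) → SamePair (gend₁ g) (gend₂ g) (gtail g) (ghead g)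
raster-ends (r , c , horiz) with even (toℕ r)
... | true = inj₁ (refl , refl)
... | false = inj₂ (refl , refl)
raster-ends (r , c , vert) with even (toℕ c)
... | true = inj₂ (refl , refl)
... | false = inj₁ (refl , refl)

gends-injective : ∀ {m} → 1 ≤ m → (g g′ : GE (2 * suc m)) →
                  SamePair (gend₁ g) (gend₂ g) (gend₁ g′) (gend₂ g′) → g ≡ g′
gends-injective _ (_ , _ , horiz) (_ , _ , horiz) (inj₁ (refl , _)) = refl
gends-injective 1≤m (_ , _ , horiz) (_ , c′ , horiz) (inj₂ (refl , eq)) = ⊥-elim (next²-≢ 1≤m c′ (cong proj₂ eq))
gends-injective _ (_ , c , horiz) (_ , _ , vert) (inj₁ (refl , eq)) = ⊥-elim (next-≢-2* c (cong proj₂ eq))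
gends-injective _ (_ , _ , horiz) (r′ , _ , vert) (inj₂ (refl , eq)) = ⊥-elim (next-≢-2* r′ (cong proj₁ eq))
gends-injective _ (r , _ , vert) (_ , _ , horiz) (inj₁ (refl , eq)) = ⊥-elim (next-≢-2* r (cong proj₁ eq))
gends-injective _ (_ , _ , vert) (_ , c′ , horiz) (inj₂ (refl , eq)) = ⊥-elim (next-≢-2* c′ (cong proj₂ eq))
gends-injective _ (_ , _ , vert) (_ , _ , vert) (inj₁ (refl , _)) = refl
gends-injective 1≤m (_ , _ , vert) (r′ , _ , vert) (inj₂ (refl , eq)) = ⊥-elim (next²-≢ 1≤m r′ (cong proj₁ eq))

module SunletCover (m : ℕ) where

  N : ℕ
  N = suc m

  φ : SV N → GV (2 * N)
  φ ((k , l) , cyc , 0F) = (2· k , 2· l)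
  φ ((k , l) , cyc , 1F) = (2· k , 1+2· l)
  φ ((k , l) , cyc , 2F) = (1+2· k , 1+2· l)
  φ ((k , l) , cyc , 3F) = (1+2· k , 2· l)
  φ ((k , l) , pend , 0F) = (2· k , 1+2· prev l)
  φ ((k , l) , pend , 1F) = (1+2· prev k , 1+2· l)
  φ ((k , l) , pend , 2F) = (1+2· k , 2· next l)
  φ ((k , l) , pend , 3F) = (2· next k , 2· l)

  pv : CV N → SV N
  pv (k , i) = (k , pend , i)

  Φ : SE N → GE (2 * N)
  Φ ((k , l) , cyc , 0F) = (2· k , 2· l , horiz)
  Φ ((k , l) , cyc , 1F) = (2· k , 1+2· l , vert)
  Φ ((k , l) , cyc , 2F) = (1+2· k , 2· l , horiz)
  Φ ((k , l) , cyc , 3F) = (2· k , 2· l , vert)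
  Φ ((k , l) , pend , 0F) = (2· k , 1+2· prev l , horiz)
  Φ ((k , l) , pend , 1F) = (1+2· prev k , 1+2· l , vert)
  Φ ((k , l) , pend , 2F) = (1+2· k , 1+2· l , horiz)
  Φ ((k , l) , pend , 3F) = (1+2· k , 2· l , vert)

  edgeAt : Dir → Fin N × Fin 2 → Fin N × Fin 2 → SE N
  edgeAt horiz (a , 0F) (b , 0F) = ((a , b) , cyc , 0F)
  edgeAt horiz (a , 0F) (b , 1F) = ((a , next b) , pend , 0F)
  edgeAt horiz (a , 1F) (b , 0F) = ((a , b) , cyc , 2F)
  edgeAt horiz (a , 1F) (b , 1F) = ((a , b) , pend , 2F)
  edgeAt vert (a , 0F) (b , 0F) = ((a , b) , cyc , 3F)
  edgeAt vert (a , 0F) (b , 1F) = ((a , b) , cyc , 1F)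
  edgeAt vert (a , 1F) (b , 0F) = ((a , b) , pend , 3F)
  edgeAt vert (a , 1F) (b , 1F) = ((next a , b) , pend , 1F)

  Φ⁻¹ : GE (2 * N) → SE N
  Φ⁻¹ (r , c , d) = edgeAt d (split r) (split c)

  Φ-edgeAt : ∀ d p q → Φ (edgeAt d p q) ≡ (uncurry join p , uncurry join q , d)
  Φ-edgeAt horiz (a , 0F) (b , 0F) = refl
  Φ-edgeAt horiz (a , 0F) (b , 1F) = cong (λ x → (2· a , 1+2· x , horiz)) (prev-next b)
  Φ-edgeAt horiz (a , 1F) (b , 0F) = refl
  Φ-edgeAt horiz (a , 1F) (b , 1F) = refl
  Φ-edgeAt vert (a , 0F) (b , 0F) = refl
  Φ-edgeAt vert (a , 0F) (b , 1F) = refl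
  Φ-edgeAt vert (a , 1F) (b , 0F) = refl
  Φ-edgeAt vert (a , 1F) (b , 1F) = cong (λ x → (1+2· x , 1+2· b , vert)) (prev-next a)

  Φ-Φ⁻¹ : (g : GE (2 * N)) → Φ (Φ⁻¹ g) ≡ g
  Φ-Φ⁻¹ (r , c , d) = trans (Φ-edgeAt d (split r) (split c))
                            (cong₂ (λ x y → (x , y , d)) (join-split {N} r) (join-split {N} c))

  Φ⁻¹-join : ∀ a x b y d → Φ⁻¹ (join a x , join b y , d) ≡ edgeAt d (a , x) (b , y)
  Φ⁻¹-join a x b y d = cong₂ (edgeAt d) (split-join a x) (split-join b y)

  Φ⁻¹-Φ : (e : SE N) → Φ⁻¹ (Φ e) ≡ e
  Φ⁻¹-Φ ((k , l) , cyc , 0F) = Φ⁻¹-join k 0F l 0F horiz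
  Φ⁻¹-Φ ((k , l) , cyc , 1F) = Φ⁻¹-join k 0F l 1F vert
  Φ⁻¹-Φ ((k , l) , cyc , 2F) = Φ⁻¹-join k 1F l 0F horiz
  Φ⁻¹-Φ ((k , l) , cyc , 3F) = Φ⁻¹-join k 0F l 0F vert
  Φ⁻¹-Φ ((k , l) , pend , 0F) =
    trans (Φ⁻¹-join k 0F (prev l) 1F horiz) (cong (λ x → ((k , x) , pend , 0F)) (next-prev l))
  Φ⁻¹-Φ ((k , l) , pend , 1F) =
    trans (Φ⁻¹-join (prev k) 1F l 1F vert) (cong (λ x → ((x , l) , pend , 1F)) (next-prev k))
  Φ⁻¹-Φ ((k , l) , pend , 2F) = Φ⁻¹-join k 1F l 1F horiz
  Φ⁻¹-Φ ((k , l) , pend , 3F) = Φ⁻¹-join k 1F l 0F vert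

  Φ-tail : (e : SE N) → gtail (Φ e) ≡ φ (stail e)
  Φ-tail ((k , l) , cyc , 0F) rewrite even-2· k = refl
  Φ-tail ((k , l) , cyc , 1F) rewrite even-1+2· l = refl
  Φ-tail ((k , l) , cyc , 2F) rewrite even-1+2· k | next-2· l = refl
  Φ-tail ((k , l) , cyc , 3F) rewrite even-2· l | next-2· k = refl
  Φ-tail ((k , l) , pend , 0F) rewrite even-2· k = refl
  Φ-tail ((k , l) , pend , 1F) rewrite even-1+2· l = refl
  Φ-tail ((k , l) , pend , 2F) rewrite even-1+2· k | next-1+2· l = refl
  Φ-tail ((k , l) , pend , 3F) rewrite even-2· l | next-1+2· k = refl

  Φ-head : (e : SE N) → ghead (Φ e) ≡ φ (shead e)
  Φ-head ((k , l) , cyc , 0F) rewrite even-2· k | next-2· l = refl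
  Φ-head ((k , l) , cyc , 1F) rewrite even-1+2· l | next-2· k = refl
  Φ-head ((k , l) , cyc , 2F) rewrite even-1+2· k = refl
  Φ-head ((k , l) , cyc , 3F) rewrite even-2· l = refl
  Φ-head ((k , l) , pend , 0F) rewrite even-2· k | next-1+2· (prev l) | next-prev l = refl
  Φ-head ((k , l) , pend , 1F) rewrite even-1+2· l | next-1+2· (prev k) | next-prev k = refl
  Φ-head ((k , l) , pend , 2F) rewrite even-1+2· k = refl
  Φ-head ((k , l) , pend , 3F) rewrite even-2· l = refl

  Φ-ends : (e : SE N) → SamePair (gend₁ (Φ e)) (gend₂ (Φ e)) (φ (stail e)) (φ (shead e))
  Φ-ends e = subst₂ (SamePair (gend₁ (Φ e)) (gend₂ (Φ e))) (Φ-tail e) (Φ-head e) (raster-ends (Φ e))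

  Φ-cycle-odd : (u : CV N) → OddSqEdge (Φ (proj₁ u , cyc , proj₂ u))
  Φ-cycle-odd ((k , l) , 0F) = even-2· l
  Φ-cycle-odd ((k , l) , 1F) = even-2· k
  Φ-cycle-odd ((k , l) , 2F) = even-2· l
  Φ-cycle-odd ((k , l) , 3F) = even-2· k

  Φ-pendant-not-odd : (u : CV N) → ¬ OddSqEdge (Φ (proj₁ u , pend , proj₂ u))
  Φ-pendant-not-odd ((k , l) , 0F) rewrite even-1+2· (prev l) = λ ()
  Φ-pendant-not-odd ((k , l) , 1F) rewrite even-1+2· (prev k) = λ ()
  Φ-pendant-not-odd ((k , l) , 2F) rewrite even-1+2· l = λ ()
  Φ-pendant-not-odd ((k , l) , 3F) rewrite even-1+2· k = λ ()

  Φ⁻¹-ends : (g : GE (2 * N)) → SamePair (φ (stail (Φ⁻¹ g))) (φ (shead (Φ⁻¹ g))) (gend₁ g) (gend₂ g)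
  Φ⁻¹-ends g = subst (λ h → SamePair (φ (stail (Φ⁻¹ g))) (φ (shead (Φ⁻¹ g))) (gend₁ h) (gend₂ h))
                     (Φ-Φ⁻¹ g) (SamePair-sym (Φ-ends (Φ⁻¹ g)))

  cornerAt : Fin N × Fin 2 → Fin N × Fin 2 → CV N
  cornerAt (a , 0F) (b , 0F) = (a , b) , 0F
  cornerAt (a , 0F) (b , 1F) = (a , b) , 1F
  cornerAt (a , 1F) (b , 1F) = (a , b) , 2F
  cornerAt (a , 1F) (b , 0F) = (a , b) , 3F

  pendantAt : Fin N × Fin 2 → Fin N × Fin 2 → CV N
  pendantAt (a , 0F) (b , 1F) = (a , next b) , 0F
  pendantAt (a , 1F) (b , 1F) = (next a , b) , 1F
  pendantAt (a , 1F) (b , 0F) = (a , prev b) , 2F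
  pendantAt (a , 0F) (b , 0F) = (prev a , b) , 3F

  cyclePreimage : GV (2 * N) → CV N
  cyclePreimage (r , c) = cornerAt (split r) (split c)

  pendantPreimage : GV (2 * N) → CV N
  pendantPreimage (r , c) = pendantAt (split r) (split c)

  φ-cornerAt : ∀ p q → φ (cv (cornerAt p q)) ≡ (uncurry join p , uncurry join q)
  φ-cornerAt (a , 0F) (b , 0F) = refl
  φ-cornerAt (a , 0F) (b , 1F) = refl
  φ-cornerAt (a , 1F) (b , 1F) = refl
  φ-cornerAt (a , 1F) (b , 0F) = refl

  φ-pendantAt : ∀ p q → φ (pv (pendantAt p q)) ≡ (uncurry join p , uncurry join q)
  φ-pendantAt (a , 0F) (b , 1F) = cong (λ x → (2· a , 1+2· x)) (prev-next b)
  φ-pendantAt (a , 1F) (b , 1F) = cong (λ x → (1+2· x , 1+2· b)) (prev-next a)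
  φ-pendantAt (a , 1F) (b , 0F) = cong (λ x → (1+2· a , 2· x)) (next-prev b)
  φ-pendantAt (a , 0F) (b , 0F) = cong (λ x → (2· x , 2· b)) (next-prev a)

  φ-cyclePreimage : (v : GV (2 * N)) → φ (cv (cyclePreimage v)) ≡ v
  φ-cyclePreimage (r , c) =
    trans (φ-cornerAt (split r) (split c)) (cong₂ _,_ (join-split {N} r) (join-split {N} c))

  φ-pendantPreimage : (v : GV (2 * N)) → φ (pv (pendantPreimage v)) ≡ v
  φ-pendantPreimage (r , c) =
    trans (φ-pendantAt (split r) (split c)) (cong₂ _,_ (join-split {N} r) (join-split {N} c))

  cyclePreimage-φ : (u : CV N) → cyclePreimage (φ (cv u)) ≡ u
  cyclePreimage-φ ((k , l) , 0F) = cong₂ cornerAt (split-join k 0F) (split-join l 0F)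
  cyclePreimage-φ ((k , l) , 1F) = cong₂ cornerAt (split-join k 0F) (split-join l 1F)
  cyclePreimage-φ ((k , l) , 2F) = cong₂ cornerAt (split-join k 1F) (split-join l 1F)
  cyclePreimage-φ ((k , l) , 3F) = cong₂ cornerAt (split-join k 1F) (split-join l 0F)

  pendantPreimage-φ : (u : CV N) → pendantPreimage (φ (pv u)) ≡ u
  pendantPreimage-φ ((k , l) , 0F) =
    trans (cong₂ pendantAt (split-join k 0F) (split-join (prev l) 1F)) (cong (λ x → (k , x) , 0F) (next-prev l))
  pendantPreimage-φ ((k , l) , 1F) =
    trans (cong₂ pendantAt (split-join (prev k) 1F) (split-join l 1F)) (cong (λ x → (x , l) , 1F) (next-prev k))
  pendantPreimage-φ ((k , l) , 2F) =
    trans (cong₂ pendantAt (split-join k 1F) (split-join (next l) 0F)) (cong (λ x → (k , x) , 2F) (prev-next l))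
  pendantPreimage-φ ((k , l) , 3F) =
    trans (cong₂ pendantAt (split-join (next k) 0F) (split-join l 0F)) (cong (λ x → (x , l) , 3F) (prev-next k))

  φ∘cv-injective : {u w : CV N} → φ (cv u) ≡ φ (cv w) → u ≡ w
  φ∘cv-injective {u} {w} eq = trans (sym (cyclePreimage-φ u)) (trans (cong cyclePreimage eq) (cyclePreimage-φ w))

  covering : 1 ≤ m → (g : GE (2 * N)) → Σ (SE N) λ e →
             SamePair (φ (stail e)) (φ (shead e)) (gend₁ g) (gend₂ g)
             × ((e′ : SE N) → SamePair (φ (stail e′)) (φ (shead e′)) (gend₁ g) (gend₂ g) → e′ ≡ e)
  covering 1≤m g = Φ⁻¹ g , Φ⁻¹-ends g , λ e′ s →
    trans (sym (Φ⁻¹-Φ e′)) (cong Φ⁻¹ (gends-injective 1≤m (Φ e′) g (SamePair-trans (Φ-ends e′) s)))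

  two-to-one : (v : GV (2 * N)) → Σ (SV N) λ x → Σ (SV N) λ y →
               x ≢ y × φ x ≡ v × φ y ≡ v × ((z : SV N) → φ z ≡ v → z ≡ x ⊎ z ≡ y)
  two-to-one v = cv (cyclePreimage v) , pv (pendantPreimage v) , (λ ()) ,
                 φ-cyclePreimage v , φ-pendantPreimage v , preimages
    where
    preimages : (z : SV N) → φ z ≡ v → z ≡ cv (cyclePreimage v) ⊎ z ≡ pv (pendantPreimage v)
    preimages (k , cyc , i) refl = inj₁ (cong cv (sym (cyclePreimage-φ (k , i))))
    preimages (k , pend , i) refl = inj₂ (cong pv (sym (pendantPreimage-φ (k , i))))

  cycle-odd-vertex : (u : CV N) → OddVertex (φ (cv u))
  cycle-odd-vertex (k , i) = Φ (k , cyc , i) , Φ-cycle-odd (k , i) , SamePair-∋ˡ (Φ-ends (k , cyc , i))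

  cycle-adj⇒odd-adj : (u w : CV N) → CycAdj u w → OddAdj (φ (cv u)) (φ (cv w))
  cycle-adj⇒odd-adj u w ((k , i) , s) =
    Φ (k , cyc , i) , Φ-cycle-odd (k , i) , SamePair-trans (Φ-ends (k , cyc , i)) (SamePair-map φ s)

  odd-adj⇒cycle-adj : (u w : CV N) → OddAdj (φ (cv u)) (φ (cv w)) → CycAdj u w
  odd-adj⇒cycle-adj u w (g , odd , s) with Φ⁻¹ g | Φ-Φ⁻¹ g
  ... | (k , cyc , i) | refl =
    (k , i) , SamePair-map cv (SamePair-reflect (φ ∘ cv) φ∘cv-injective
                                (SamePair-trans (SamePair-sym (Φ-ends (k , cyc , i))) s))
  ... | (k , pend , i) | refl = ⊥-elim (Φ-pendant-not-odd (k , i) odd)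

  φ-compatible : (u w : SV N) → FSMArc u w → RasterArc (φ u) (φ w)
  φ-compatible _ _ (e , refl , refl) = Φ e , Φ-tail e , Φ-head e

theorem3 : (n : ℕ) → 2 ≤ n →
  Σ (SV n → GV (2 * n)) λ φ →
    -- homomorphism
    ((e : SE n) → GAdj (φ (stail e)) (φ (shead e)))
    -- covering: induced edge map is a bijection
    × ((g : GE (2 * n)) → Σ (SE n) λ e →
         SamePair (φ (stail e)) (φ (shead e)) (gend₁ g) (gend₂ g)
         × ((e′ : SE n) → SamePair (φ (stail e′)) (φ (shead e′)) (gend₁ g) (gend₂ g) → e′ ≡ e))
    -- 2-to-1 on vertices
    × ((v : GV (2 * n)) → Σ (SV n) λ x → Σ (SV n) λ y →
         x ≢ y × φ x ≡ v × φ y ≡ v × ((z : SV n) → φ z ≡ v → z ≡ x ⊎ z ≡ y))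
    -- restriction to the cycles is an isomorphism onto the union of odd squares
    × ((u : CV n) → OddVertex (φ (cv u)))
    × ((u w : CV n) → φ (cv u) ≡ φ (cv w) → u ≡ w)
    × ((v : GV (2 * n)) → OddVertex v → Σ (CV n) λ u → φ (cv u) ≡ v)
    × ((u w : CV n) → CycAdj u w → OddAdj (φ (cv u)) (φ (cv w)))
    × ((u w : CV n) → OddAdj (φ (cv u)) (φ (cv w)) → CycAdj u w)
    -- compatible with FSM and raster orientations
    × ((u w : SV n) → FSMArc u w → RasterArc (φ u) (φ w))
theorem3 zero ()
theorem3 (suc m) (s≤s 1≤m) =
  φ , (λ e → Φ e , Φ-ends e) , covering 1≤m , two-to-one ,
  cycle-odd-vertex , (λ _ _ → φ∘cv-injective) ,
  -- the odd squares cover the whole torus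
  (λ v _ → cyclePreimage v , φ-cyclePreimage v) ,
  cycle-adj⇒odd-adj , odd-adj⇒cycle-adj , φ-compatible
  where open SunletCover m
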